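{- Let $k+1$ and $p>k(k+1)$ be odd primes. Then every $\mathbf{u}\in(\mathbb{Z}/(k+1)p\mathbb{Z})^k$ with $\pi_{(k+1)p\to p}(\mathbf{u})=(1,2,\ldots,k)$ is $(k,p,k+1)$-proper. In particular, $(1,2,\ldots,k)$ is eventually $(k,p)$-proper.
   Context: For a real number $x$, $\lVert x\rVert$ denotes the distance from $x$ to the nearest integer. For positive integers $n\mid m$, $\pi_{m\to n}:\mathbb{Z}/m\mathbb{Z}\to\mathbb{Z}/n\mathbb{Z}$ is the natural projection (coordinatewise on tuples). For a prime $p$ and positive integer $l$, $\mathbb{Z}_{p,l}$ is the set of residues in $\mathbb{Z}/pl\mathbb{Z}$ not congruent to $0$ mod $p$. A tuple $\mathbf{v}\in\mathbb{Z}_{p,l}^k$ is $(k,p,l)$-proper if (i) some index $i$ has $\gcd(l,v_1,\ldots,v_{i-1},v_{i+1},\ldots,v_k)>1$ (computed with integer representatives), or (ii) some $t\in\frac1{lp}\mathbb{Z}$ has $\lVert tv_i\rVert\ge\frac1{k+1}$ for all $i$; otherwise it is $(k,p,l)$-improper, and $I(k,p,l)$ is the set of improper tuples. A tuple $\mathbf{v}\in\mathbb{Z}_{p,1}^k$ is eventually $(k,p)$-proper if there exists a positive integer $l$ with $\mathbf{v}\notin\pi_{lp\to p}(I(k,p,l))$. -}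

module Defs where

open import Data.Nat as ℕ using (ℕ; zero; suc; _+_; _*_; _<_; _>_)
open import Data.Nat.GCD using (gcd)
open import Data.Nat.Divisibility using (_∣_)
open import Data.Fin using (Fin; toℕ; _≟_)
open import Data.List using (List; []; _∷_; foldr; filter; map)
open import Data.Fin.Base using () 
open import Data.List.Base using ()
open import Data.Integer as ℤ using (ℤ; +_)
open import Data.Rational as ℚ using (ℚ; floor; ceiling; _⊓_; _-_; _≤_)
import Data.Rational.Base as ℚB
open import Data.Product using (Σ; ∃; ∃-syntax; _×_)
open import Data.Sum using (_⊎_)
open import Relation.Nullary using (¬_)
open import Relation.Binary.PropositionalEquality using (_≡_; _≢_)
open import Relation.Nullary.Decidable using (¬?)
import Data.List as L

toℚ : ℤ → ℚ
toℚ a = a ℚ./ 1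

‖_‖ : ℚ → ℚ
‖ x ‖ = (x - toℚ (floor x)) ⊓ (toℚ (ceiling x) - x)

-- a k-tuple of residues, represented by natural-number representatives
Tuple : ℕ → Set
Tuple k = Fin k → ℕ

InZpl : (k p l : ℕ) → Tuple k → Set
InZpl k p l v = ∀ i → (v i < p * l) × ¬ (p ∣ v i)

gcdExcept : {k : ℕ} → ℕ → Tuple k → Fin k → ℕ
gcdExcept {k} l v i =
  foldr gcd l (map v (filter (λ j → ¬? (j ≟ i)) (L.allFin k)))

Proper : (k p l : ℕ) → Tuple k → Set
Proper k p l v =
    (∃[ i ] gcdExcept l v i > 1)
  ⊎ (∃[ t ] ((∃[ a ] t ℚ.* toℚ (+ (l * p)) ≡ toℚ a)
             × (∀ i → ((+ 1) ℚ./ suc k) ≤ ‖ t ℚ.* toℚ (+ v i) ‖)))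

Improper : (k p l : ℕ) → Tuple k → Set
Improper k p l v = ¬ Proper k p l v

-- π_{pl→p}(w) = v : w_i ≡ v_i (mod p), where v_i is the representative in [0,p)
Proj : {k : ℕ} → (p : ℕ) → Tuple k → Tuple k → Set
Proj p w v = ∀ i → ∃[ q ] w i ≡ q * p + v i

-- v ∈ ℤ_{p,1}^k is eventually (k,p)-proper:
-- ∃ l > 0 with v ∉ π_{lp→p}(I(k,p,l))
EventuallyProper : (k p : ℕ) → Tuple k → Set
EventuallyProper k p v =
  ∃[ l ] (l > 0 × (∀ w → InZpl k p l w → Proj p w v → ¬ Improper k p l w))

oneToK : (k : ℕ) → Tuple k
oneToK k i = suc (toℕ i)

{-# OPTIONS --safe #-}
module Submission where

-- Write q = k + 1 and u i = c i · p + i.  If no u i is divisible by q, then t = 1/q works; if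
-- all are, q divides every gcdExcept.  Otherwise the pairs (i, c i) are not all proportional
-- mod q, and there are x, z with x i + z c i ≢ 0, −1 (mod q) for every i.  Taking a = x p + y
-- with a ≡ z (mod q) and 0 ≤ y < q gives a u i ≡ (x i + z c i) p + y i (mod qp) with
-- 0 ≤ y i < p, so t = a/(qp) keeps every t u i at distance at least 1/q from ℤ.
-- The point (x, z) exists by a polynomial count: were there none, rescaling would show that
-- for each x the values x i + c i either contain 0 or run through all nonzero residues, so
-- Σₓ ∏ᵢ (x i + c i) ≡ k! · #{x : no root}.  Expanding the product, the power sums Σₓ xʲ
-- vanish for j < k and Σₓ xᵏ ≡ −1 (Fermat), so exactly k values of x have no root; but the
-- two distinct roots −c i₀ / i₀ and −c j₀ / j₀ leave at most k − 1 of them.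

open import Defs

open import Data.Empty using (⊥-elim)
open import Data.Fin as F using (Fin; toℕ; fromℕ; inject₁; punchOut)
import Data.Fin.Properties as Finₚ
open Finₚ using (toℕ-inject₁; toℕ-fromℕ)
open import Data.Fin.Permutation using (permutation; _⟨$⟩ʳ_)
open import Data.Integer as ℤ using (ℤ; +_; -[1+_]) renaming (suc to sucℤ)
import Data.Integer.DivMod as ℤ
import Data.Integer.Properties as ℤ
open import Data.Integer.Tactic.RingSolver using (solve-∀)
open import Data.List using (List; []; _∷_; foldr; map; filter; allFin)
open import Data.Nat as ℕ using (ℕ; zero; suc; _+_; _*_; _^_; _∸_; _%_; _≤_; _<_; z≤n; s≤s)
open import Data.Nat.Combinatorics using (_C_; nCn≡1; nC1≡n; nCk≡nC[n∸k])
open import Data.Nat.Coprimality using (prime⇒coprime; coprime-Bézout)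
open import Data.Nat.Divisibility
  using (_∣_; ∣-refl; ∣-trans; ∣-antisym; ∣1⇒≡1; m%n≡0⇒n∣m; n∣m⇒m%n≡0)
open import Data.Nat.DivMod
import Data.Nat.GCD as GCD
open GCD using (gcd; gcd-greatest; gcd[m,n]∣n)
open import Data.Nat.Induction using (<-rec)
open import Data.Nat.Primality using (Prime; euclidsLemma; ¬prime[1])
open import Data.Nat.Properties
open import Data.Nat.Solver using (module +-*-Solver)
open +-*-Solver using (solve; _:+_; _:*_; _:=_; con)
open import Data.Product using (∃; ∃-syntax; _×_; _,_; proj₁; proj₂)
open import Data.Rational as ℚ using (ℚ; mkℚ; floor; ceiling)
import Data.Rational.Properties as ℚ
open import Data.Rational.Unnormalised as ℚᵘ using (mkℚᵘ; *≤*; *<*; *≡*; _≃_)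
import Data.Rational.Unnormalised.Properties as ℚᵘ
open import Data.Sum as ⊎ using (_⊎_; inj₁; inj₂; [_,_])
open import Data.Vec.Functional using (removeAt)
open import Function using (_∘_)
open import Relation.Binary.Bundles using (Setoid)
open import Relation.Binary.PropositionalEquality hiding ([_])
import Relation.Binary.Reasoning.Setoid
open import Relation.Binary.Structures using (IsEquivalence)
open import Relation.Nullary using (¬_; Dec; yes; no; map′)
open import Relation.Nullary.Decidable using (_⊎-dec_; ¬?; decidable-stable)

open import Algebra.Properties.Semiring.Sum +-*-semiring
  using ( sum; sum-syntax; sum⁺-syntax; ∑-comm; ∑-distrib-+; sum-remove; *-distribˡ-sum
        ; sum-init-last; sum-cong-≗)
open import Algebra.Properties.CommutativeMonoid.Sum *-1-commutativeMonoid
  using () renaming (sum to ∏; sum-remove to ∏-remove; sum-permute to ∏-permute; sum-cong-≗ to ∏-cong-≗)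
import Algebra.Properties.CommutativeSemiring.Binomial +-*-commutativeSemiring as Binomial
import Algebra.Definitions.RawSemiring as RawSemiring

-- The semiring-generic ×ₘ and ^ₘ in which the library states the binomial theorem.
open RawSemiring ℕ.+-*-rawSemiring using () renaming (_×_ to _×ₘ_; _^_ to _^ₘ_)

-- Finite sums, products and power sums

×ₘ≡* : ∀ m n → m ×ₘ n ≡ m * n
×ₘ≡* zero    n = refl
×ₘ≡* (suc m) n = cong (_+_ n) (×ₘ≡* m n)

^ₘ≡^ : ∀ m n → m ^ₘ n ≡ m ^ n
^ₘ≡^ m zero    = refl
^ₘ≡^ m (suc n) = cong (m *_) (^ₘ≡^ m n)

binomial-theorem : ∀ x n → (x + 1) ^ n ≡ ∑[ l ≤ n ] ((n C toℕ l) * x ^ toℕ l)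
binomial-theorem x n = begin
  (x + 1) ^ n                            ≡⟨ ^ₘ≡^ (x + 1) n ⟨
  (x + 1) ^ₘ n                           ≡⟨ Binomial.theorem n x 1 ⟩
  Binomial.binomialExpansion x 1 n       ≡⟨ sum-cong-≗ {suc n} term ⟩
  ∑[ l ≤ n ] ((n C toℕ l) * x ^ toℕ l)   ∎
  where
  open ≡-Reasoning
  term : ∀ l → Binomial.binomialTerm x 1 n l ≡ (n C toℕ l) * x ^ toℕ l
  term l = begin
    (n C toℕ l) ×ₘ (x ^ₘ toℕ l * 1 ^ₘ (n ∸ toℕ l))
      ≡⟨ ×ₘ≡* (n C toℕ l) _ ⟩
    (n C toℕ l) * (x ^ₘ toℕ l * 1 ^ₘ (n ∸ toℕ l))
      ≡⟨ cong₂ (λ a b → (n C toℕ l) * (a * b))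
               (^ₘ≡^ x (toℕ l)) (trans (^ₘ≡^ 1 (n ∸ toℕ l)) (^-zeroˡ (n ∸ toℕ l))) ⟩
    (n C toℕ l) * (x ^ toℕ l * 1)
      ≡⟨ cong ((n C toℕ l) *_) (*-identityʳ (x ^ toℕ l)) ⟩
    (n C toℕ l) * x ^ toℕ l ∎

∑-ones : ∀ n → ∑[ x < n ] 1 ≡ n
∑-ones zero    = refl
∑-ones (suc n) = cong suc (∑-ones n)

∑-≤-size : ∀ {n} (f : Fin n → ℕ) → (∀ i → f i ≤ 1) → sum f ≤ n
∑-≤-size {zero}  f _   = z≤n
∑-≤-size {suc n} f f≤1 = +-mono-≤ (f≤1 F.zero) (∑-≤-size (f ∘ F.suc) (f≤1 ∘ F.suc))

∑-two-zeros : ∀ {n} (f : Fin n → ℕ) → (∀ i → f i ≤ 1) →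
              ∀ {i j} → i ≢ j → f i ≡ 0 → f j ≡ 0 → 2 + sum f ≤ n
∑-two-zeros {suc zero}    f _   {F.zero} {F.zero} i≢j _ _ = ⊥-elim (i≢j refl)
∑-two-zeros {suc (suc n)} f f≤1 {i} {j} i≢j fi≡0 fj≡0 = s≤s (s≤s (begin
  sum f                          ≡⟨ sum-remove {i = i} f ⟩
  f i + sum g                    ≡⟨ cong (_+ sum g) fi≡0 ⟩
  sum g                          ≡⟨ sum-remove {i = j′} g ⟩
  g j′ + sum (removeAt g j′)     ≡⟨ cong (_+ sum (removeAt g j′)) gj′≡0 ⟩
  sum (removeAt g j′)            ≤⟨ ∑-≤-size (removeAt g j′) (λ _ → f≤1 _) ⟩
  n                              ∎))
  where
  open ≤-Reasoning
  g = removeAt f i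
  j′ = punchOut i≢j
  gj′≡0 : g j′ ≡ 0
  gj′≡0 = trans (cong f (Finₚ.punchIn-punchOut i≢j)) fj≡0

powerSum : ℕ → ℕ → ℕ
powerSum N j = ∑[ x < N ] (toℕ x ^ j)

∑-shift : ∀ N (f : ℕ → ℕ) → ∑[ x < N ] f (suc (toℕ x)) + f 0 ≡ ∑[ x < N ] f (toℕ x) + f N
∑-shift N f = begin
  ∑[ x < N ] f (suc (toℕ x)) + f 0
    ≡⟨ +-comm _ (f 0) ⟩
  ∑[ x < suc N ] f (toℕ x)
    ≡⟨ sum-init-last {N} (f ∘ toℕ) ⟩
  ∑[ x < N ] f (toℕ (inject₁ x)) + f (toℕ (fromℕ N))
    ≡⟨ cong₂ _+_ (sum-cong-≗ {N} (cong f ∘ toℕ-inject₁)) (cong f (toℕ-fromℕ N)) ⟩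
  ∑[ x < N ] f (toℕ x) + f N ∎
  where open ≡-Reasoning

powerSum-recurrence : ∀ N n → ∑[ l ≤ n ] ((suc n C toℕ l) * powerSum N (toℕ l)) ≡ N ^ suc n
powerSum-recurrence N n = +-cancelˡ-≡ (powerSum N m) _ _ (begin
  powerSum N m + ∑[ l ≤ n ] T (toℕ l)
    ≡⟨ +-comm (powerSum N m) _ ⟩
  ∑[ l ≤ n ] T (toℕ l) + powerSum N m
    ≡⟨ cong (_+_ (∑[ l ≤ n ] T (toℕ l))) (trans (cong (_* powerSum N m) (nCn≡1 m)) (*-identityˡ _)) ⟨
  ∑[ l ≤ n ] T (toℕ l) + T m
    ≡⟨ cong₂ _+_ (sum-cong-≗ {suc n} (cong T ∘ toℕ-inject₁)) (cong T (toℕ-fromℕ m)) ⟨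
  ∑[ l ≤ n ] T (toℕ (inject₁ l)) + T (toℕ (fromℕ m))
    ≡⟨ sum-init-last {suc n} (T ∘ toℕ) ⟨
  ∑[ l ≤ m ] T (toℕ l)
    ≡⟨ sum-cong-≗ {suc m} (λ l → *-distribˡ-sum {N} (m C toℕ l) (λ x → toℕ x ^ toℕ l)) ⟩
  ∑[ l ≤ m ] ∑[ x < N ] ((m C toℕ l) * toℕ x ^ toℕ l)
    ≡⟨ ∑-comm {N} {suc m} (λ x l → (m C toℕ l) * toℕ x ^ toℕ l) ⟨
  ∑[ x < N ] ∑[ l ≤ m ] ((m C toℕ l) * toℕ x ^ toℕ l)
    ≡⟨ sum-cong-≗ {N} (λ x → binomial-theorem (toℕ x) m) ⟨
  ∑[ x < N ] ((toℕ x + 1) ^ m)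
    ≡⟨ sum-cong-≗ {N} (λ x → cong (_^ m) (+-comm (toℕ x) 1)) ⟩
  ∑[ x < N ] (suc (toℕ x) ^ m)
    ≡⟨ +-identityʳ _ ⟨
  ∑[ x < N ] (suc (toℕ x) ^ m) + 0 ^ m
    ≡⟨ ∑-shift N (_^ m) ⟩
  powerSum N m + N ^ m ∎)
  where
  open ≡-Reasoning
  m = suc n
  T : ℕ → ℕ
  T l = (m C l) * powerSum N l

∏-scale : ∀ {n} x (f : Fin n → ℕ) → ∏ (λ i → x * f i) ≡ x ^ n * ∏ f
∏-scale {zero}  x f = refl
∏-scale {suc n} x f = begin
  x * f F.zero * ∏ (λ i → x * f (F.suc i))   ≡⟨ cong (x * f F.zero *_) (∏-scale x (f ∘ F.suc)) ⟩
  x * f F.zero * (x ^ n * ∏ (f ∘ F.suc))     ≡⟨ solve 4 (λ x a b c → x :* a :* (b :* c) := x :* b :* (a :* c))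
                                                        refl x (f F.zero) (x ^ n) (∏ (f ∘ F.suc)) ⟩
  x * x ^ n * (f F.zero * ∏ (f ∘ F.suc))     ∎
  where open ≡-Reasoning

injective⇒surjective : ∀ {n} (f : Fin n → Fin n) → (∀ {i j} → f i ≡ f j → i ≡ j) →
                       ∀ j → ∃[ i ] f i ≡ j
injective⇒surjective {suc n} f f-inj j with Finₚ.any? (λ i → f i Finₚ.≟ j)
... | yes hit = hit
... | no miss with Finₚ.pigeonhole (n<1+n n) (λ i → punchOut (λ fi≡j → miss (i , sym fi≡j)))
...   | i , i′ , i<i′ , eq =
  ⊥-elim (Finₚ.<-irrefl (f-inj (Finₚ.punchOut-injective {i = j} _ _ eq)) i<i′)

surjective⇒permutation : ∀ {n} (f : Fin n → Fin n) → (∀ j → ∃[ i ] f i ≡ j) →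
                         ∃[ π ] (∀ i → π ⟨$⟩ʳ i ≡ f i)
surjective⇒permutation f f-surj = permutation f section f∘section section∘f , λ _ → refl
  where
  section = proj₁ ∘ f-surj
  f∘section : ∀ j → f (section j) ≡ j
  f∘section = proj₂ ∘ f-surj
  section∘f : ∀ i → section (f i) ≡ i
  section∘f i with injective⇒surjective section
                     (λ {j} {j′} e → trans (sym (f∘section j)) (trans (cong f e) (f∘section j′))) i
  ... | j , refl = cong section (f∘section j)

-- Rationals

toℚᵘ-toℚ : ∀ z → ℚ.toℚᵘ (toℚ z) ≃ mkℚᵘ z 0
toℚᵘ-toℚ z = ℚ.toℚᵘ-fromℚᵘ (mkℚᵘ z 0)

≤-viaᵘ : ∀ {x y X Y} → ℚ.toℚᵘ x ≃ X → ℚ.toℚᵘ y ≃ Y → X ℚᵘ.≤ Y → x ℚ.≤ y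
≤-viaᵘ x≃X y≃Y X≤Y =
  ℚ.toℚᵘ-cancel-≤ (ℚᵘ.≤-respʳ-≃ (ℚᵘ.≃-sym y≃Y) (ℚᵘ.≤-respˡ-≃ (ℚᵘ.≃-sym x≃X) X≤Y))

<-viaᵘ : ∀ {x y X Y} → ℚ.toℚᵘ x ≃ X → ℚ.toℚᵘ y ≃ Y → X ℚᵘ.< Y → x ℚ.< y
<-viaᵘ x≃X y≃Y X<Y =
  ℚ.toℚᵘ-cancel-< (ℚᵘ.<-respʳ-≃ (ℚᵘ.≃-sym y≃Y) (ℚᵘ.<-respˡ-≃ (ℚᵘ.≃-sym x≃X) X<Y))

fracᵘ-≤ : ∀ {a b c d} → a * suc d ≤ c * suc b → mkℚᵘ (+ a) b ℚᵘ.≤ mkℚᵘ (+ c) d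
fracᵘ-≤ {a} {b} {c} {d} h = *≤* (subst₂ ℤ._≤_ (ℤ.pos-* a (suc d)) (ℤ.pos-* c (suc b)) (ℤ.+≤+ h))

fracᵘ-< : ∀ {a b c d} → a * suc d < c * suc b → mkℚᵘ (+ a) b ℚᵘ.< mkℚᵘ (+ c) d
fracᵘ-< {a} {b} {c} {d} h = *<* (subst₂ ℤ._<_ (ℤ.pos-* a (suc d)) (ℤ.pos-* c (suc b)) (ℤ.+<+ h))

pos-linear : ∀ v a b → + (v + a * b) ≡ + v ℤ.+ + a ℤ.* + b
pos-linear v a b = trans (ℤ.pos-+ v (a * b)) (cong (λ z → + v ℤ.+ z) (ℤ.pos-* a b))

floor-unique : ∀ {x : ℚ} {n : ℤ} → toℚ n ℚ.≤ x → x ℚ.< toℚ (sucℤ n) → floor x ≡ n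
floor-unique {x@(mkℚ N d-1 _)} {n} n≤x x<n+1 = ℤ.≤-antisym ⌊x⌋≤n n≤⌊x⌋
  where
  d = suc d-1
  n*d≤N : n ℤ.* + d ℤ.≤ N
  n*d≤N = subst (n ℤ.* + d ℤ.≤_) (ℤ.*-identityʳ N)
            (ℚᵘ.drop-*≤* (ℚᵘ.≤-respˡ-≃ (toℚᵘ-toℚ n) (ℚ.toℚᵘ-mono-≤ n≤x)))
  N<[n+1]*d : N ℤ.< sucℤ n ℤ.* + d
  N<[n+1]*d = subst (ℤ._< sucℤ n ℤ.* + d) (ℤ.*-identityʳ N)
                (ℚᵘ.drop-*<* (ℚᵘ.<-respʳ-≃ (toℚᵘ-toℚ (sucℤ n)) (ℚ.toℚᵘ-mono-< x<n+1)))
  ⌊x⌋≡N/d : floor x ≡ N ℤ./ℕ d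
  ⌊x⌋≡N/d = ℤ.div-pos-is-/ℕ N d
  ⌊x⌋≤n : floor x ℤ.≤ n
  ⌊x⌋≤n = subst₂ ℤ._≤_ (sym ⌊x⌋≡N/d) (ℤ.pred-suc n) (ℤ.i<j⇒i≤pred[j]
            (ℤ.*-cancelʳ-<-nonNeg {N ℤ./ℕ d} {sucℤ n} (+ d)
              (ℤ.≤-<-trans (ℤ.[n/ℕd]*d≤n N d) N<[n+1]*d)))
  n≤⌊x⌋ : n ℤ.≤ floor x
  n≤⌊x⌋ = subst (n ℤ.≤_) (trans (ℤ.pred-suc _) (sym ⌊x⌋≡N/d)) (ℤ.i<j⇒i≤pred[j]
            (ℤ.*-cancelʳ-<-nonNeg {n} {sucℤ (N ℤ./ℕ d)} (+ d)
              (ℤ.≤-<-trans n*d≤N (ℤ.n<s[n/ℕd]*d N d))))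

fractional-part : ∀ n V m → mkℚᵘ (+ (V + n * suc m)) m ℚᵘ.- mkℚᵘ (+ n) 0 ≃ mkℚᵘ (+ V) m
fractional-part n V m = *≡* (begin
  (+ (V + n * M) ℤ.* + 1 ℤ.+ ℤ.- (+ n) ℤ.* + M) ℤ.* + M
    ≡⟨ cong (λ z → (z ℤ.* + 1 ℤ.+ ℤ.- (+ n) ℤ.* + M) ℤ.* + M) (pos-linear V n M) ⟩
  ((+ V ℤ.+ + n ℤ.* + M) ℤ.* + 1 ℤ.+ ℤ.- (+ n) ℤ.* + M) ℤ.* + M
    ≡⟨ solve-∀′ (+ V) (+ n) (+ M) ⟩
  + V ℤ.* + M
    ≡⟨ cong (λ z → + V ℤ.* + z) (*-identityʳ M) ⟨
  + V ℤ.* + (M * 1) ∎)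
  where
  open ≡-Reasoning
  M = suc m
  solve-∀′ : ∀ (v a b : ℤ) → ((v ℤ.+ a ℤ.* b) ℤ.* + 1 ℤ.+ ℤ.- a ℤ.* b) ℤ.* b ≡ v ℤ.* b
  solve-∀′ = solve-∀

complementary-part : ∀ n V W m → V + W ≡ suc m →
                     mkℚᵘ (+ suc n) 0 ℚᵘ.- mkℚᵘ (+ (V + n * suc m)) m ≃ mkℚᵘ (+ W) m
complementary-part n V W m V+W≡M = *≡* (begin
  (+ suc n ℤ.* + M ℤ.+ ℤ.- (+ (V + n * M)) ℤ.* + 1) ℤ.* + M
    ≡⟨ cong (λ z → (+ suc n ℤ.* + M ℤ.+ ℤ.- z ℤ.* + 1) ℤ.* + M) (pos-linear V n M) ⟩
  (+ suc n ℤ.* + M ℤ.+ ℤ.- (+ V ℤ.+ + n ℤ.* + M) ℤ.* + 1) ℤ.* + M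
    ≡⟨ cong₂ (λ s z → (s ℤ.* z ℤ.+ ℤ.- (+ V ℤ.+ + n ℤ.* z) ℤ.* + 1) ℤ.* z) (ℤ.pos-+ 1 n) M≡V+W ⟩
  ((+ 1 ℤ.+ + n) ℤ.* V+W ℤ.+ ℤ.- (+ V ℤ.+ + n ℤ.* V+W) ℤ.* + 1) ℤ.* V+W
    ≡⟨ solve-∀′ (+ n) (+ V) (+ W) ⟩
  + W ℤ.* V+W
    ≡⟨ cong (λ z → + W ℤ.* z) (trans (cong +_ (*-identityˡ M)) M≡V+W) ⟨
  + W ℤ.* + (1 * M) ∎)
  where
  open ≡-Reasoning
  M = suc m
  V+W = + V ℤ.+ + W
  M≡V+W : + M ≡ V+W
  M≡V+W = trans (cong +_ (sym V+W≡M)) (ℤ.pos-+ V W)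
  solve-∀′ : ∀ (a v w : ℤ) →
             ((+ 1 ℤ.+ a) ℤ.* (v ℤ.+ w) ℤ.+ ℤ.- (v ℤ.+ a ℤ.* (v ℤ.+ w)) ℤ.* + 1) ℤ.* (v ℤ.+ w) ≡ w ℤ.* (v ℤ.+ w)
  solve-∀′ = solve-∀

toℚᵘ-homo-difference : ∀ x y → ℚ.toℚᵘ (x ℚ.- y) ≃ ℚ.toℚᵘ x ℚᵘ.- ℚ.toℚᵘ y
toℚᵘ-homo-difference x y =
  ℚᵘ.≃-trans (ℚ.toℚᵘ-homo-+ x (ℚ.- y)) (ℚᵘ.+-congʳ (ℚ.toℚᵘ x) (ℚ.toℚᵘ-homo‿- y))

ceiling-unique : ∀ {x : ℚ} n → toℚ (+ n) ℚ.< x → x ℚ.≤ toℚ (+ suc n) → ceiling x ≡ + suc n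
ceiling-unique {x@(mkℚ _ _ _)} n n<x x≤n+1 =
  cong ℤ.-_ (floor-unique {ℚ.- x} { -[1+ n ]} (ℚ.neg-antimono-≤ x≤n+1)
                (subst (ℚ.- x ℚ.<_) (sym (toℚ-[-n] n)) (ℚ.neg-antimono-< n<x)))
  where
  toℚ-[-n] : ∀ n → toℚ (sucℤ -[1+ n ]) ≡ ℚ.- toℚ (+ n)
  toℚ-[-n] zero    = refl
  toℚ-[-n] (suc n) = refl

module Fraction {x : ℚ} {N m : ℕ} (x≃N/M : ℚ.toℚᵘ x ≃ mkℚᵘ (+ N) m) where

  M n V : ℕ
  M = suc m
  n = N / M
  V = N % M

  private
    x≃ : ℚ.toℚᵘ x ≃ mkℚᵘ (+ (V + n * M)) m
    x≃ = subst (λ N → ℚ.toℚᵘ x ≃ mkℚᵘ (+ N) m) (m≡m%n+[m/n]*n N M) x≃N/M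
    N≡N*1 : V + n * M ≡ (V + n * M) * 1
    N≡N*1 = sym (*-identityʳ (V + n * M))

  n≤x : toℚ (+ n) ℚ.≤ x
  n≤x = ≤-viaᵘ {toℚ (+ n)} (toℚᵘ-toℚ (+ n)) x≃ (fracᵘ-≤ (subst (n * M ≤_) N≡N*1 (m≤n+m (n * M) V)))

  n<x : 0 < V → toℚ (+ n) ℚ.< x
  n<x 0<V = <-viaᵘ {toℚ (+ n)} (toℚᵘ-toℚ (+ n)) x≃ (fracᵘ-< (subst (n * M <_) N≡N*1 (m<n+m (n * M) 0<V)))

  x<n+1 : x ℚ.< toℚ (+ suc n)
  x<n+1 = <-viaᵘ {x} {toℚ (+ suc n)} x≃ (toℚᵘ-toℚ (+ suc n))
            (fracᵘ-< (subst (_< suc n * M) N≡N*1 (+-monoˡ-< (n * M) (m%n<n N M))))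

  x-n≃V/M : ℚ.toℚᵘ (x ℚ.- toℚ (+ n)) ≃ mkℚᵘ (+ V) m
  x-n≃V/M = ℚᵘ.≃-trans (toℚᵘ-homo-difference x (toℚ (+ n)))
              (ℚᵘ.≃-trans (ℚᵘ.+-cong x≃ (ℚᵘ.-‿cong (toℚᵘ-toℚ (+ n)))) (fractional-part n V m))

  n+1-x≃[M∸V]/M : ℚ.toℚᵘ (toℚ (+ suc n) ℚ.- x) ≃ mkℚᵘ (+ (M ∸ V)) m
  n+1-x≃[M∸V]/M = ℚᵘ.≃-trans (toℚᵘ-homo-difference (toℚ (+ suc n)) x)
                    (ℚᵘ.≃-trans (ℚᵘ.+-cong (toℚᵘ-toℚ (+ suc n)) (ℚᵘ.-‿cong x≃))
                      (complementary-part n V (M ∸ V) m (m+[n∸m]≡n (<⇒≤ (m%n<n N M)))))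

  ‖‖-lower-bound : ∀ k → M ≤ suc k * V → suc k * V + M ≤ suc k * M → + 1 ℚ./ suc k ℚ.≤ ‖ x ‖
  ‖‖-lower-bound k M≤qV qV+M≤qM =
    subst₂ (λ ⌊x⌋ ⌈x⌉ → + 1 ℚ./ q ℚ.≤ (x ℚ.- toℚ ⌊x⌋) ℚ.⊓ (toℚ ⌈x⌉ ℚ.- x))
           (sym (floor-unique {x} {+ n} n≤x x<n+1)) (sym (ceiling-unique {x} n (n<x 0<V) (ℚ.<⇒≤ x<n+1)))
           (ℚ.⊓-glb (≤-viaᵘ {+ 1 ℚ./ q} {x ℚ.- toℚ (+ n)} 1/q≃ x-n≃V/M 1/q≤V/M)
                    (≤-viaᵘ {+ 1 ℚ./ q} {toℚ (+ suc n) ℚ.- x} 1/q≃ n+1-x≃[M∸V]/M 1/q≤[M∸V]/M))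
    where
    q = suc k
    0<V : 0 < V
    0<V = n≢0⇒n>0 λ V≡0 → <⇒≱ (s≤s z≤n)
            (≤-trans (subst (λ v → M ≤ q * v) V≡0 M≤qV) (≤-reflexive (*-zeroʳ q)))
    1/q≃ : ℚ.toℚᵘ (+ 1 ℚ./ q) ≃ mkℚᵘ (+ 1) k
    1/q≃ = ℚ.toℚᵘ-fromℚᵘ (mkℚᵘ (+ 1) k)
    1/q≤V/M : mkℚᵘ (+ 1) k ℚᵘ.≤ mkℚᵘ (+ V) m
    1/q≤V/M = fracᵘ-≤ (subst₂ _≤_ (sym (*-identityˡ M)) (*-comm q V) M≤qV)
    1/q≤[M∸V]/M : mkℚᵘ (+ 1) k ℚᵘ.≤ mkℚᵘ (+ (M ∸ V)) m
    1/q≤[M∸V]/M = fracᵘ-≤ (begin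
      1 * M              ≡⟨ *-identityˡ M ⟩
      M                  ≤⟨ m+n≤o⇒m≤o∸n M (subst (_≤ q * M) (+-comm (q * V) M) qV+M≤qM) ⟩
      q * M ∸ q * V      ≡⟨ *-distribˡ-∸ q M V ⟨
      q * (M ∸ V)        ≡⟨ *-comm q (M ∸ V) ⟩
      (M ∸ V) * q        ∎)
      where open ≤-Reasoning

scaled-product : ∀ a u m → ℚ.toℚᵘ ((+ a ℚ./ suc m) ℚ.* toℚ (+ u)) ≃ mkℚᵘ (+ (a * u)) m
scaled-product a u m =
  ℚᵘ.≃-trans (ℚ.toℚᵘ-homo-* (+ a ℚ./ suc m) (toℚ (+ u)))
    (ℚᵘ.≃-trans (ℚᵘ.*-cong (ℚ.toℚᵘ-fromℚᵘ (mkℚᵘ (+ a) m)) (toℚᵘ-toℚ (+ u)))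
      (*≡* (cong₂ ℤ._*_ (sym (ℤ.pos-* a u)) (cong +_ (sym (*-identityʳ (suc m)))))))

scaled-denominator : ∀ a m → (+ a ℚ./ suc m) ℚ.* toℚ (+ suc m) ≡ toℚ (+ a)
scaled-denominator a m =
  ℚ.toℚᵘ-injective (ℚᵘ.≃-trans (scaled-product a (suc m) m)
    (ℚᵘ.≃-trans (*≡* (trans (ℤ.*-identityʳ _) (ℤ.pos-* a (suc m))))
      (ℚᵘ.≃-sym (toℚᵘ-toℚ (+ a)))))

-- Arithmetic modulo q = k + 1, in which k represents −1

module Residues (k : ℕ) where

  q : ℕ
  q = suc k

  infix 4 _≈_
  record _≈_ (a b : ℕ) : Set where
    constructor congruent
    field residue-≡ : a % q ≡ b % q
  open _≈_ public

  ≈-isEquivalence : IsEquivalence _≈_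
  ≈-isEquivalence = record
    { refl  = congruent refl
    ; sym   = λ (congruent e) → congruent (sym e)
    ; trans = λ (congruent e) (congruent f) → congruent (trans e f)
    }

  ≈-setoid : Setoid _ _
  ≈-setoid = record { isEquivalence = ≈-isEquivalence }

  open IsEquivalence ≈-isEquivalence public
    using () renaming (refl to ≈-refl; sym to ≈-sym; trans to ≈-trans)

  module ≈-Reasoning = Relation.Binary.Reasoning.Setoid ≈-setoid

  ≡⇒≈ : ∀ {a b} → a ≡ b → a ≈ b
  ≡⇒≈ e = congruent (cong (_% q) e)

  _≈?_ : ∀ a b → Dec (a ≈ b)
  a ≈? b = map′ congruent residue-≡ (a % q ℕ.≟ b % q)

  +-cong : ∀ {a b c d} → a ≈ b → c ≈ d → a + c ≈ b + d
  +-cong {a} {b} {c} {d} (congruent e) (congruent f) = congruent (begin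
    (a + c) % q             ≡⟨ %-distribˡ-+ a c q ⟩
    (a % q + c % q) % q     ≡⟨ cong₂ (λ x y → (x + y) % q) e f ⟩
    (b % q + d % q) % q     ≡⟨ %-distribˡ-+ b d q ⟨
    (b + d) % q             ∎)
    where open ≡-Reasoning

  *-cong : ∀ {a b c d} → a ≈ b → c ≈ d → a * c ≈ b * d
  *-cong {a} {b} {c} {d} (congruent e) (congruent f) = congruent (begin
    (a * c) % q             ≡⟨ %-distribˡ-* a c q ⟩
    (a % q * (c % q)) % q   ≡⟨ cong₂ (λ x y → (x * y) % q) e f ⟩
    (b % q * (d % q)) % q   ≡⟨ %-distribˡ-* b d q ⟨
    (b * d) % q             ∎)
    where open ≡-Reasoning

  +-congˡ : ∀ a {b c} → b ≈ c → a + b ≈ a + c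
  +-congˡ a = +-cong (≈-refl {a})
  +-congʳ : ∀ a {b c} → b ≈ c → b + a ≈ c + a
  +-congʳ a e = +-cong e (≈-refl {a})
  *-congˡ : ∀ a {b c} → b ≈ c → a * b ≈ a * c
  *-congˡ a = *-cong (≈-refl {a})
  *-congʳ : ∀ a {b c} → b ≈ c → b * a ≈ c * a
  *-congʳ a e = *-cong e (≈-refl {a})

  %-≈ : ∀ a → a % q ≈ a
  %-≈ a = congruent (m%n%n≡m%n a q)

  m*q≈0 : ∀ m → m * q ≈ 0
  m*q≈0 m = congruent (m*n%n≡0 m q)

  a*k+a≈0 : ∀ a → a * k + a ≈ 0
  a*k+a≈0 a = ≈-trans (≡⇒≈ (solve 2 (λ a k → a :* k :+ a := a :* (con 1 :+ k)) refl a k)) (m*q≈0 a)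

  ≈-<⇒≡ : ∀ {a b} → a < q → b < q → a ≈ b → a ≡ b
  ≈-<⇒≡ a<q b<q (congruent e) = trans (sym (m<n⇒m%n≡m a<q)) (trans e (m<n⇒m%n≡m b<q))

  <q⇒≉0 : ∀ {a} → 0 < a → a < q → ¬ a ≈ 0
  <q⇒≉0 0<a a<q a≈0 = <⇒≢ 0<a (sym (≈-<⇒≡ a<q (s≤s z≤n) a≈0))

  ≈0⇒∣ : ∀ {a} → a ≈ 0 → q ∣ a
  ≈0⇒∣ {a} (congruent e) = m%n≡0⇒n∣m a q e

  ∣⇒≈0 : ∀ {a} → q ∣ a → a ≈ 0
  ∣⇒≈0 {a} q∣a = congruent (n∣m⇒m%n≡0 a q q∣a)

  residue : ℕ → Fin q
  residue a = F.fromℕ< (m%n<n a q)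

  toℕ-residue : ∀ a → toℕ (residue a) ≈ a
  toℕ-residue a = ≈-trans (≡⇒≈ (Finₚ.toℕ-fromℕ< (m%n<n a q))) (%-≈ a)

  ∃-residue? : {P : ℕ → Set} → (∀ x → Dec (P x)) → (∀ {x y} → x ≈ y → P x → P y) →
               Dec (∃ P)
  ∃-residue? P? P-resp with Finₚ.any? (P? ∘ toℕ)
  ... | yes (x , Px) = yes (toℕ x , Px)
  ... | no  none     = no λ (x , Px) → none (residue x , P-resp (≈-sym (toℕ-residue x)) Px)

  ∑≈0 : ∀ {n} {f : Fin n → ℕ} → (∀ i → f i ≈ 0) → sum f ≈ 0
  ∑≈0 {zero}  f≈0 = ≈-refl
  ∑≈0 {suc n} f≈0 = +-cong (f≈0 F.zero) (∑≈0 (f≈0 ∘ F.suc))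

  ∑-cong : ∀ {n} {f g : Fin n → ℕ} → (∀ i → f i ≈ g i) → sum f ≈ sum g
  ∑-cong {zero}  f≈g = ≈-refl
  ∑-cong {suc n} f≈g = +-cong (f≈g F.zero) (∑-cong (f≈g ∘ F.suc))

  ∏-cong : ∀ {n} {f g : Fin n → ℕ} → (∀ i → f i ≈ g i) → ∏ f ≈ ∏ g
  ∏-cong {zero}  f≈g = ≈-refl
  ∏-cong {suc n} f≈g = *-cong (f≈g F.zero) (∏-cong (f≈g ∘ F.suc))

  ∏-zero : ∀ {n} (f : Fin n → ℕ) i → f i ≈ 0 → ∏ f ≈ 0
  ∏-zero {suc n} f i fi≈0 = begin
    ∏ f                      ≡⟨ ∏-remove {i = i} f ⟩
    f i * ∏ (removeAt f i)   ≈⟨ *-congʳ (∏ (removeAt f i)) fi≈0 ⟩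
    0                        ∎
    where open ≈-Reasoning

module PrimeResidues (k : ℕ) (q-prime : Prime (suc k)) where
  open Residues k public

  1≉0 : ¬ 1 ≈ 0
  1≉0 1≈0 = ¬prime[1] (subst Prime (∣1⇒≡1 (≈0⇒∣ 1≈0)) q-prime)

  0<k : 0 < k
  0<k = n≢0⇒n>0 λ k≡0 → 1≉0 (∣⇒≈0 (subst (λ m → suc m ∣ 1) (sym k≡0) ∣-refl))

  zero-product : ∀ {a b} → ¬ a ≈ 0 → ¬ b ≈ 0 → ¬ a * b ≈ 0
  zero-product a≉0 b≉0 ab≈0 =
    [ a≉0 ∘ ∣⇒≈0 , b≉0 ∘ ∣⇒≈0 ] (euclidsLemma _ _ q-prime (≈0⇒∣ ab≈0))

  ∏-nonzero : ∀ {n} (f : Fin n → ℕ) → (∀ i → ¬ f i ≈ 0) → ¬ ∏ f ≈ 0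
  ∏-nonzero {zero}  f _   = 1≉0
  ∏-nonzero {suc n} f f≉0 = zero-product (f≉0 F.zero) (∏-nonzero (f ∘ F.suc) (f≉0 ∘ F.suc))

  inverse : ∀ {a} → ¬ a ≈ 0 → ∃[ b ] a * b ≈ 1
  inverse {a} a≉0 with a % q in a%q≡r | m%n<n a q
  ... | zero  | _   = ⊥-elim (a≉0 (congruent a%q≡r))
  ... | suc r | r<q with coprime-Bézout (prime⇒coprime q-prime r<q)
  ...   | GCD.Bézout.-+ x y eq = y , (begin
    a * y            ≈⟨ *-congʳ y (≈-trans (≈-sym (%-≈ a)) (≡⇒≈ a%q≡r)) ⟩
    suc r * y        ≡⟨ trans (*-comm (suc r) y) (sym eq) ⟩
    1 + x * q        ≈⟨ +-congˡ 1 (m*q≈0 x) ⟩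
    1 + 0            ∎)
    where open ≈-Reasoning
  ...   | GCD.Bézout.+- x y eq = y * k , (begin
    a * (y * k)              ≈⟨ *-congʳ (y * k) (≈-trans (≈-sym (%-≈ a)) (≡⇒≈ a%q≡r)) ⟩
    suc r * (y * k)          ≡⟨ solve 3 (λ r y k → r :* (y :* k) := y :* r :* k :+ con 0) refl (suc r) y k ⟩
    w * k + 0                ≈⟨ +-congˡ (w * k) w+1≈0 ⟨
    w * k + (w + 1)          ≡⟨ +-assoc (w * k) w 1 ⟨
    w * k + w + 1            ≈⟨ +-congʳ 1 (a*k+a≈0 w) ⟩
    0 + 1                    ∎)
    where
    open ≈-Reasoning
    w = y * suc r
    w+1≈0 : w + 1 ≈ 0
    w+1≈0 = ≈-trans (≡⇒≈ (trans (+-comm w 1) eq)) (m*q≈0 x)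

  inverse≉0 : ∀ {a b} → a * b ≈ 1 → ¬ b ≈ 0
  inverse≉0 {a} ab≈1 b≈0 =
    1≉0 (≈-trans (≈-sym ab≈1) (≈-trans (*-congˡ a b≈0) (≡⇒≈ (*-zeroʳ a))))

  *-cancelˡ : ∀ {s a b} → ¬ s ≈ 0 → s * a ≈ s * b → a ≈ b
  *-cancelˡ {s} {a} {b} s≉0 sa≈sb = begin
    a              ≡⟨ *-identityˡ a ⟨
    1 * a          ≈⟨ *-congʳ a st≈1 ⟨
    s * t * a      ≡⟨ solve 3 (λ s t a → s :* t :* a := t :* (s :* a)) refl s t a ⟩
    t * (s * a)    ≈⟨ *-congˡ t sa≈sb ⟩
    t * (s * b)    ≡⟨ solve 3 (λ s t a → t :* (s :* a) := s :* t :* a) refl s t b ⟩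
    s * t * b      ≈⟨ *-congʳ b st≈1 ⟩
    1 * b          ≡⟨ *-identityˡ b ⟩
    b              ∎
    where
    open ≈-Reasoning
    t = proj₁ (inverse s≉0)
    st≈1 = proj₂ (inverse s≉0)

  nonzero-residue : ∀ {a} → ¬ a ≈ 0 → ∃[ j ] a % q ≡ oneToK k j
  nonzero-residue {a} a≉0 with a % q in a%q≡r | m%n<n a q
  ... | zero  | _         = ⊥-elim (a≉0 (congruent a%q≡r))
  ... | suc r | s≤s r<k   = F.fromℕ< r<k , cong suc (sym (Finₚ.toℕ-fromℕ< r<k))

  ∏-nonzero-residues : (g : Fin k → ℕ) → (∀ i → ¬ g i ≈ 0) → (∀ j → ∃[ i ] g i ≈ oneToK k j) →
                       ∏ g ≈ ∏ (oneToK k)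
  ∏-nonzero-residues g g≉0 g-onto = begin
    ∏ g                              ≈⟨ ∏-cong (λ i → ≈-trans (≈-sym (%-≈ (g i))) (≡⇒≈ (index-≡ i))) ⟩
    ∏ (oneToK k ∘ index)             ≡⟨ ∏-cong-≗ {k} (cong (oneToK k) ∘ proj₂ π) ⟨
    ∏ (oneToK k ∘ (proj₁ π ⟨$⟩ʳ_))   ≡⟨ ∏-permute (oneToK k) (proj₁ π) ⟨
    ∏ (oneToK k)                     ∎
    where
    open ≈-Reasoning
    index : Fin k → Fin k
    index i = proj₁ (nonzero-residue (g≉0 i))
    index-≡ : ∀ i → g i % q ≡ oneToK k (index i)
    index-≡ i = proj₂ (nonzero-residue (g≉0 i))
    index-onto : ∀ j → ∃[ i ] index i ≡ j
    index-onto j with g-onto j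
    ... | i , congruent gi≡j = i , Finₚ.toℕ-injective (suc-injective
      (trans (sym (index-≡ i)) (trans gi≡j (m<n⇒m%n≡m (s≤s (Finₚ.toℕ<n j))))))
    π = surjective⇒permutation index index-onto

  oneToK≉0 : ∀ i → ¬ oneToK k i ≈ 0
  oneToK≉0 i = <q⇒≉0 (s≤s z≤n) (s≤s (Finₚ.toℕ<n i))

  ∏oneToK≉0 : ¬ ∏ (oneToK k) ≈ 0
  ∏oneToK≉0 = ∏-nonzero (oneToK k) oneToK≉0

  fermat : ∀ {x} → ¬ x ≈ 0 → x ^ k ≈ 1
  fermat {x} x≉0 = *-cancelˡ ∏oneToK≉0 (begin
    W * x ^ k                    ≡⟨ *-comm W (x ^ k) ⟩
    x ^ k * W                    ≡⟨ ∏-scale x (oneToK k) ⟨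
    ∏ (λ i → x * oneToK k i)     ≈⟨ ∏-nonzero-residues _ (zero-product x≉0 ∘ oneToK≉0) onto ⟩
    W                            ≡⟨ *-identityʳ W ⟨
    W * 1                        ∎)
    where
    open ≈-Reasoning
    W = ∏ (oneToK k)
    y = proj₁ (inverse x≉0)
    xy≈1 = proj₂ (inverse x≉0)
    onto : ∀ j → ∃[ i ] x * oneToK k i ≈ oneToK k j
    onto j with nonzero-residue (zero-product (inverse≉0 {x} xy≈1) (oneToK≉0 j))
    ... | i , yj%q≡i = i , (begin
      x * oneToK k i             ≈⟨ *-congˡ x (≈-trans (≡⇒≈ (sym yj%q≡i)) (%-≈ (y * oneToK k j))) ⟩
      x * (y * oneToK k j)       ≡⟨ *-assoc x y _ ⟨
      x * y * oneToK k j         ≈⟨ *-congʳ (oneToK k j) xy≈1 ⟩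
      1 * oneToK k j             ≡⟨ *-identityˡ _ ⟩
      oneToK k j                 ∎)

  powerSum≈0 : ∀ j → j < k → powerSum q j ≈ 0
  powerSum≈0 = <-rec _ λ j rec j<k → vanishes j (λ l → rec (Finₚ.toℕ<n l) (<-trans (Finₚ.toℕ<n l) j<k)) j<k
    where
    S = powerSum q
    vanishes : ∀ j → (∀ (l : Fin j) → S (toℕ l) ≈ 0) → j < k → S j ≈ 0
    vanishes j lower≈0 j<k = *-cancelˡ (<q⇒≉0 (s≤s z≤n) (s≤s j<k)) (begin
      suc j * S j                                          ≡⟨ cong (_* S j) [1+j]Cj≡1+j ⟨
      T j                                                  ≈⟨ +-congʳ (T j) (∑≈0 lower-term≈0) ⟨
      ∑[ l < j ] T (toℕ l) + T j
        ≡⟨ cong₂ _+_ (sum-cong-≗ {j} (cong T ∘ toℕ-inject₁)) (cong T (toℕ-fromℕ j)) ⟨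
      ∑[ l < j ] T (toℕ (inject₁ l)) + T (toℕ (fromℕ j))   ≡⟨ sum-init-last {j} (T ∘ toℕ) ⟨
      ∑[ l ≤ j ] T (toℕ l)                                 ≡⟨ powerSum-recurrence q j ⟩
      q ^ suc j                                            ≡⟨ *-comm q (q ^ j) ⟩
      q ^ j * q                                            ≈⟨ m*q≈0 (q ^ j) ⟩
      0                                                    ≡⟨ *-zeroʳ (suc j) ⟨
      suc j * 0                                            ∎)
      where
      open ≈-Reasoning
      T : ℕ → ℕ
      T l = (suc j C l) * S l
      [1+j]Cj≡1+j : suc j C j ≡ suc j
      [1+j]Cj≡1+j = trans (nCk≡nC[n∸k] (n≤1+n j)) (trans (cong (suc j C_) (m+n∸n≡m 1 j)) (nC1≡n (suc j)))
      lower-term≈0 : ∀ (l : Fin j) → T (toℕ l) ≈ 0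
      lower-term≈0 l = ≈-trans (*-congˡ (suc j C toℕ l) (lower≈0 l)) (≡⇒≈ (*-zeroʳ (suc j C toℕ l)))

  powerSum≈k : powerSum q k ≈ k
  powerSum≈k = begin
    0 ^ k + ∑[ x < k ] (suc (toℕ x) ^ k)    ≡⟨ cong (_+ ∑[ x < k ] (suc (toℕ x) ^ k)) (0^n≡0 0<k) ⟩
    ∑[ x < k ] (suc (toℕ x) ^ k)
      ≈⟨ ∑-cong (fermat ∘ <q⇒≉0 (s≤s z≤n) ∘ s≤s ∘ Finₚ.toℕ<n) ⟩
    ∑[ x < k ] 1                            ≡⟨ ∑-ones k ⟩
    k                                       ∎
    where
    open ≈-Reasoning
    0^n≡0 : ∀ {n} → 0 < n → 0 ^ n ≡ 0
    0^n≡0 (s≤s _) = refl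

  ∑-∏-linear : ∀ m j (a b : Fin m → ℕ) → m + j ≤ k →
               ∑[ x < q ] (toℕ x ^ j * ∏ (λ i → toℕ x * a i + b i)) ≈ ∏ a * powerSum q (m + j)
  ∑-∏-linear zero j a b _ =
    ≡⇒≈ (trans (sum-cong-≗ {q} (λ x → *-identityʳ (toℕ x ^ j))) (sym (*-identityˡ (powerSum q j))))
  ∑-∏-linear (suc m) j a b m+j<k = begin
    ∑[ x < q ] (toℕ x ^ j * ((toℕ x * a₀ + b₀) * P x))
      ≡⟨ sum-cong-≗ {q} (λ x → expand (toℕ x ^ j) (toℕ x) (P x)) ⟩
    ∑[ x < q ] (a₀ * (toℕ x ^ suc j * P x) + b₀ * (toℕ x ^ j * P x))
      ≡⟨ ∑-distrib-+ {q} (λ x → a₀ * (toℕ x ^ suc j * P x)) (λ x → b₀ * (toℕ x ^ j * P x)) ⟩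
    ∑[ x < q ] (a₀ * (toℕ x ^ suc j * P x)) + ∑[ x < q ] (b₀ * (toℕ x ^ j * P x))
      ≡⟨ cong₂ _+_ (*-distribˡ-sum {q} a₀ (λ x → toℕ x ^ suc j * P x))
                   (*-distribˡ-sum {q} b₀ (λ x → toℕ x ^ j * P x)) ⟨
    a₀ * ∑[ x < q ] (toℕ x ^ suc j * P x) + b₀ * ∑[ x < q ] (toℕ x ^ j * P x)
      ≈⟨ +-cong (*-congˡ a₀ higher) (*-congˡ b₀ lower≈0) ⟩
    a₀ * (∏ (a ∘ F.suc) * powerSum q (m + suc j)) + b₀ * 0
      ≡⟨ cong₂ (λ n z → a₀ * (∏ (a ∘ F.suc) * powerSum q n) + z) (+-suc m j) (*-zeroʳ b₀) ⟩
    a₀ * (∏ (a ∘ F.suc) * powerSum q (suc m + j)) + 0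
      ≡⟨ trans (+-identityʳ _) (sym (*-assoc a₀ (∏ (a ∘ F.suc)) _)) ⟩
    ∏ a * powerSum q (suc m + j) ∎
    where
    open ≈-Reasoning
    a₀ = a F.zero
    b₀ = b F.zero
    P : Fin q → ℕ
    P x = ∏ (λ i → toℕ x * a (F.suc i) + b (F.suc i))
    expand : ∀ xʲ x p → xʲ * ((x * a₀ + b₀) * p) ≡ a₀ * (x * xʲ * p) + b₀ * (xʲ * p)
    expand xʲ x p = solve 5 (λ xʲ x a b p → xʲ :* ((x :* a :+ b) :* p) := a :* (x :* xʲ :* p) :+ b :* (xʲ :* p))
                            refl xʲ x a₀ b₀ p
    higher : ∑[ x < q ] (toℕ x ^ suc j * P x) ≈ ∏ (a ∘ F.suc) * powerSum q (m + suc j)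
    higher = ∑-∏-linear m (suc j) (a ∘ F.suc) (b ∘ F.suc) (≤-trans (≤-reflexive (+-suc m j)) m+j<k)
    lower≈0 : ∑[ x < q ] (toℕ x ^ j * P x) ≈ 0
    lower≈0 = begin
      ∑[ x < q ] (toℕ x ^ j * P x)
        ≈⟨ ∑-∏-linear m j (a ∘ F.suc) (b ∘ F.suc) (≤-trans (n≤1+n _) m+j<k) ⟩
      ∏ (a ∘ F.suc) * powerSum q (m + j) ≈⟨ *-congˡ (∏ (a ∘ F.suc)) (powerSum≈0 (m + j) m+j<k) ⟩
      ∏ (a ∘ F.suc) * 0                  ≡⟨ *-zeroʳ (∏ (a ∘ F.suc)) ⟩
      0                                  ∎

  module Avoidance (c : Fin k → ℕ) where

    form : ℕ → ℕ → Fin k → ℕ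
    form x z i = x * oneToK k i + z * c i

    Hits : ℕ → ℕ → Fin k → Set
    Hits x z i = form x z i ≈ 0 ⊎ form x z i ≈ k

    Avoids : ℕ → ℕ → Set
    Avoids x z = ∀ i → ¬ Hits x z i

    hits? : ∀ x z i → Dec (Hits x z i)
    hits? x z i = (form x z i ≈? 0) ⊎-dec (form x z i ≈? k)

    avoids-resp : ∀ {x x′ z z′} → x ≈ x′ → z ≈ z′ → Avoids x z → Avoids x′ z′
    avoids-resp x≈x′ z≈z′ avoids i =
      avoids i ∘ ⊎.map (≈-trans form≈) (≈-trans form≈)
      where
      form≈ = +-cong (*-congʳ (oneToK k i) x≈x′) (*-congʳ (c i) z≈z′)

    avoids? : ∀ x z → Dec (Avoids x z)
    avoids? x z = Finₚ.all? (¬? ∘ hits? x z)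

    ¬avoids⇒hits : ∀ {x z} → ¬ Avoids x z → ∃[ i ] Hits x z i
    ¬avoids⇒hits {x} {z} ¬avoids with Finₚ.¬∀⟶∃¬ k _ (¬? ∘ hits? x z) ¬avoids
    ... | i , ¬¬hits = i , decidable-stable (hits? x z i) ¬¬hits

    line : ℕ → Fin k → ℕ
    line x i = x * oneToK k i + c i

    HasRoot : ℕ → Set
    HasRoot x = ∃[ i ] line x i ≈ 0

    hasRoot? : ∀ x → Dec (HasRoot x)
    hasRoot? x = Finₚ.any? (λ i → line x i ≈? 0)

    rootless : ℕ → ℕ
    rootless x with hasRoot? x
    ... | yes _ = 0
    ... | no  _ = 1

    rootless≤1 : ∀ x → rootless x ≤ 1
    rootless≤1 x with hasRoot? x
    ... | yes _ = z≤n
    ... | no  _ = s≤s z≤n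

    rootless≡0 : ∀ {x} → HasRoot x → rootless x ≡ 0
    rootless≡0 {x} root with hasRoot? x
    ... | yes _      = refl
    ... | no  ¬root  = ⊥-elim (¬root root)

    common-root⇒proportional : ∀ r {i j} → line r i ≈ 0 → line r j ≈ 0 →
                               c i * oneToK k j ≈ c j * oneToK k i
    common-root⇒proportional r {i} {j} ri≈0 rj≈0 = begin
      c i * A j                        ≡⟨ +-identityʳ _ ⟨
      c i * A j + 0                    ≈⟨ +-congˡ (c i * A j) (*-congʳ (A i) rj≈0) ⟨
      c i * A j + line r j * A i
        ≡⟨ solve 5 (λ r a b cᵢ cⱼ → cᵢ :* b :+ (r :* b :+ cⱼ) :* a := (r :* a :+ cᵢ) :* b :+ cⱼ :* a)
                   refl r (A i) (A j) (c i) (c j) ⟩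
      line r i * A j + c j * A i       ≈⟨ +-congʳ (c j * A i) (*-congʳ (A j) ri≈0) ⟩
      0 + c j * A i                    ∎
      where
      open ≈-Reasoning
      A = oneToK k

    root : Fin k → ℕ
    root i = k * c i * proj₁ (inverse (oneToK≉0 i))

    root-is-root : ∀ i → line (root i) i ≈ 0
    root-is-root i = begin
      k * c i * v * oneToK k i + c i
        ≡⟨ cong (_+ c i) (solve 4 (λ k c v a → k :* c :* v :* a := c :* k :* (a :* v)) refl k (c i) v (oneToK k i)) ⟩
      c i * k * (oneToK k i * v) + c i     ≈⟨ +-congʳ (c i) (*-congˡ (c i * k) (proj₂ (inverse (oneToK≉0 i)))) ⟩
      c i * k * 1 + c i                    ≡⟨ cong (_+ c i) (*-identityʳ (c i * k)) ⟩
      c i * k + c i                        ≈⟨ a*k+a≈0 (c i) ⟩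
      0                                    ∎
      where
      open ≈-Reasoning
      v = proj₁ (inverse (oneToK≉0 i))

    line-cong : ∀ {x y} i → x ≈ y → line x i ≈ line y i
    line-cong i x≈y = +-congʳ (c i) (*-congʳ (oneToK k i) x≈y)

    module _ (never : ∀ x z → ¬ Avoids x z) where

      -- At (x s, s) with s = −μ⁻¹ the form is s · line x, so hitting −1 there means line x = μ.
      line-onto : ∀ {x} → ¬ HasRoot x → ∀ j → ∃[ i ] line x i ≈ oneToK k j
      line-onto {x} ¬root j = hit⇒value (¬avoids⇒hits {x * s} {s} (never (x * s) s))
        where
        μ = oneToK k j
        μ⁻¹ = proj₁ (inverse (oneToK≉0 j))
        μμ⁻¹≈1 = proj₂ (inverse (oneToK≉0 j))
        s = k * μ⁻¹
        s≉0 : ¬ s ≈ 0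
        s≉0 = zero-product (<q⇒≉0 0<k (n<1+n k)) (inverse≉0 {μ} μμ⁻¹≈1)
        sμ≈k : s * μ ≈ k
        sμ≈k = begin
          k * μ⁻¹ * μ    ≡⟨ solve 3 (λ k m m⁻¹ → k :* m⁻¹ :* m := k :* (m :* m⁻¹)) refl k μ μ⁻¹ ⟩
          k * (μ * μ⁻¹)  ≈⟨ *-congˡ k μμ⁻¹≈1 ⟩
          k * 1          ≡⟨ *-identityʳ k ⟩
          k              ∎
          where open ≈-Reasoning
        scaled : ∀ i → form (x * s) s i ≡ s * line x i
        scaled i = solve 4 (λ x s a c → x :* s :* a :+ s :* c := s :* (x :* a :+ c)) refl x s (oneToK k i) (c i)
        hit⇒value : ∃[ i ] Hits (x * s) s i → ∃[ i ] line x i ≈ μ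
        hit⇒value (i , inj₁ ≈0) =
          ⊥-elim (zero-product s≉0 (λ e → ¬root (i , e)) (≈-trans (≡⇒≈ (sym (scaled i))) ≈0))
        hit⇒value (i , inj₂ ≈k) =
          i , *-cancelˡ s≉0 (≈-trans (≡⇒≈ (sym (scaled i))) (≈-trans ≈k (≈-sym sμ≈k)))

      ∏-line : ∀ x → ∏ (line x) ≈ ∏ (oneToK k) * rootless x
      ∏-line x with hasRoot? x
      ... | yes (i , root) =
        ≈-trans (∏-zero (line x) i root) (≡⇒≈ (sym (*-zeroʳ (∏ (oneToK k)))))
      ... | no  ¬root      =
        ≈-trans (∏-nonzero-residues (line x) (λ i e → ¬root (i , e)) (line-onto {x} ¬root))
                (≡⇒≈ (sym (*-identityʳ (∏ (oneToK k)))))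

      rootless-count : ∑[ x < q ] rootless (toℕ x) ≈ k
      rootless-count = *-cancelˡ ∏oneToK≉0 (begin
        W * ∑[ x < q ] rootless (toℕ x)              ≡⟨ *-distribˡ-sum {q} W (rootless ∘ toℕ) ⟩
        ∑[ x < q ] (W * rootless (toℕ x))            ≈⟨ ∑-cong {q} (∏-line ∘ toℕ) ⟨
        ∑[ x < q ] ∏ (line (toℕ x))
          ≡⟨ sum-cong-≗ {q} (*-identityˡ ∘ ∏ ∘ line ∘ toℕ) ⟨
        ∑[ x < q ] (toℕ x ^ 0 * ∏ (line (toℕ x)))
          ≈⟨ ∑-∏-linear k 0 (oneToK k) c (≤-reflexive (+-identityʳ k)) ⟩
        W * powerSum q (k + 0)                       ≡⟨ cong (λ n → W * powerSum q n) (+-identityʳ k) ⟩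
        W * powerSum q k                             ≈⟨ *-congˡ W powerSum≈k ⟩
        W * k                                        ∎)
        where
        open ≈-Reasoning
        W = ∏ (oneToK k)

    some-point-avoids : ∀ {i₀ j₀} → ¬ c i₀ * oneToK k j₀ ≈ c j₀ * oneToK k i₀ →
                        ¬ (∀ x z → ¬ Avoids x z)
    some-point-avoids {i₀} {j₀} independent never =
      1+n≰n (ℕ.s≤s⁻¹ (subst (λ n → 2 + n ≤ q) count≡k two-roots))
      where
      count = ∑[ x < q ] rootless (toℕ x)
      residue-root : ∀ i → line (toℕ (residue (root i))) i ≈ 0
      residue-root i = ≈-trans (line-cong i (toℕ-residue (root i))) (root-is-root i)
      distinct : residue (root i₀) ≢ residue (root j₀)
      distinct same = independent (common-root⇒proportional (toℕ (residue (root i₀))) (residue-root i₀)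
                                    (subst (λ r → line (toℕ r) j₀ ≈ 0) (sym same) (residue-root j₀)))
      two-roots : 2 + count ≤ q
      two-roots = ∑-two-zeros (rootless ∘ toℕ) (rootless≤1 ∘ toℕ) distinct
                              (rootless≡0 (i₀ , residue-root i₀)) (rootless≡0 (j₀ , residue-root j₀))
      count≡k : count ≡ k
      count≡k = ≈-<⇒≡ (≤-trans (n≤1+n _) two-roots) (n<1+n k) (rootless-count never)

    ∃-avoiding? : ∀ x → Dec (∃[ z ] Avoids x z)
    ∃-avoiding? x = ∃-residue? (avoids? x) (avoids-resp (≈-refl {x}))

    ∃-avoiding-resp : ∀ {x x′} → x ≈ x′ → ∃[ z ] Avoids x z → ∃[ z ] Avoids x′ z
    ∃-avoiding-resp x≈x′ (z , avoids) = z , avoids-resp x≈x′ (≈-refl {z}) avoids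

    avoiding-point : ∀ {i₀ j₀} → ¬ c i₀ * oneToK k j₀ ≈ c j₀ * oneToK k i₀ →
                     ∃[ x ] ∃[ z ] Avoids x z
    avoiding-point independent with ∃-residue? ∃-avoiding? ∃-avoiding-resp
    ... | yes found = found
    ... | no  none  = ⊥-elim (some-point-avoids independent (λ x z avoids → none (x , z , avoids)))

-- Proper tuples

∣-foldr-gcd : ∀ {A : Set} {d l} (f : A → ℕ) (xs : List A) → d ∣ l → (∀ x → d ∣ f x) →
              d ∣ foldr gcd l (map f xs)
∣-foldr-gcd f []       d∣l d∣f = d∣l
∣-foldr-gcd f (x ∷ xs) d∣l d∣f = gcd-greatest (d∣f x) (∣-foldr-gcd f xs d∣l d∣f)

foldr-gcd-∣ : ∀ l (xs : List ℕ) → foldr gcd l xs ∣ l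
foldr-gcd-∣ l []       = ∣-refl
foldr-gcd-∣ l (x ∷ xs) = ∣-trans (gcd[m,n]∣n x _) (foldr-gcd-∣ l xs)

gcdExcept-common-divisor : ∀ {k} l (v : Tuple k) i → (∀ j → l ∣ v j) → gcdExcept l v i ≡ l
gcdExcept-common-divisor {k} l v i l∣v =
  ∣-antisym (foldr-gcd-∣ l (map v others)) (∣-foldr-gcd v others ∣-refl l∣v)
  where others = filter (λ j → ¬? (j Finₚ.≟ i)) (allFin k)

module Properness (k p′ : ℕ) (q-prime : Prime (suc k)) (kq<p : k * suc k < suc p′) where
  open PrimeResidues k q-prime

  p : ℕ
  p = suc p′

  Middle : ℕ → Set
  Middle N = p ≤ N % (q * p) × N % (q * p) + p ≤ q * p

  proper-by-multiplier : ∀ (u : Tuple k) a → (∀ i → Middle (a * u i)) → Proper k p q u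
  proper-by-multiplier u a middle = inj₂ (+ a ℚ./ (q * p) , (+ a , scaled-denominator a _) , bound)
    where
    bound : ∀ i → + 1 ℚ./ q ℚ.≤ ‖ (+ a ℚ./ (q * p)) ℚ.* toℚ (+ u i) ‖
    bound i = Fraction.‖‖-lower-bound (scaled-product a (u i) _) k (*-monoʳ-≤ q (proj₁ (middle i)))
                (subst (_≤ q * (q * p)) (*-distribˡ-+ q _ p) (*-monoʳ-≤ q (proj₂ (middle i))))

  middle-digits : ∀ R B → B < p → 0 < R % q → R % q * p + B + p ≤ q * p → Middle (R * p + B)
  middle-digits R B B<p 0<r r*p+B+p≤q*p =
    subst (λ V → p ≤ V × V + p ≤ q * p) (sym digits) (p≤r*p+B , r*p+B+p≤q*p)
    where
    digits : (R * p + B) % (q * p) ≡ R % q * p + B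
    digits = trans ([m*n+o]%[p*n]≡[m*n]%[p*n]+o R q B<p) (cong (_+ B) (sym (m%n*o≡m*o%[n*o] R q p)))
    p≤r*p+B : p ≤ R % q * p + B
    p≤r*p+B = ≤-trans (≤-trans (≤-reflexive (sym (*-identityˡ p))) (*-monoˡ-≤ p 0<r)) (m≤m+n _ B)

  units-proper : (u : Tuple k) → (∀ i → ¬ u i ≈ 0) → Proper k p q u
  units-proper u u≉0 = proper-by-multiplier u p middle
    where
    middle : ∀ i → Middle (p * u i)
    middle i = subst Middle (trans (+-identityʳ (u i * p)) (*-comm (u i) p))
                 (middle-digits (u i) 0 (s≤s z≤n) (n≢0⇒n>0 (u≉0 i ∘ congruent)) bound)
      where
      r = u i % q
      bound : r * p + 0 + p ≤ q * p
      bound = subst (_≤ q * p) (solve 2 (λ r p → (con 1 :+ r) :* p := r :* p :+ con 0 :+ p) refl r p)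
                (*-monoˡ-≤ p (m%n<n (u i) q))

  divisible-proper : (u : Tuple k) → (∀ i → u i ≈ 0) → Proper k p q u
  divisible-proper u u≈0 =
    inj₁ (i₀ , subst (1 <_) (sym (gcdExcept-common-divisor q u i₀ (≈0⇒∣ ∘ u≈0))) (s≤s 0<k))
    where
    i₀ : Fin k
    i₀ = F.fromℕ< 0<k

  module _ (u : Tuple k) (lift : Proj p u (oneToK k)) where

    private
      A = oneToK k
      c : Fin k → ℕ
      c i = proj₁ (lift i)
      u≡ : ∀ i → u i ≡ c i * p + A i
      u≡ i = proj₂ (lift i)

    proportional⇒u-proportional : ∀ {i j} → c i * A j ≈ c j * A i → A i * u j ≈ A j * u i
    proportional⇒u-proportional {i} {j} cᵢAⱼ≈cⱼAᵢ = begin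
      A i * u j                    ≡⟨ cong (A i *_) (u≡ j) ⟩
      A i * (c j * p + A j)
        ≡⟨ solve 4 (λ a b c p → a :* (c :* p :+ b) := a :* b :+ p :* (c :* a)) refl (A i) (A j) (c j) p ⟩
      A i * A j + p * (c j * A i)  ≈⟨ +-congˡ (A i * A j) (*-congˡ p cᵢAⱼ≈cⱼAᵢ) ⟨
      A i * A j + p * (c i * A j)
        ≡⟨ solve 4 (λ a b c p → a :* b :+ p :* (c :* b) := b :* (c :* p :+ a)) refl (A i) (A j) (c i) p ⟩
      A j * (c i * p + A i)        ≡⟨ cong (A j *_) (u≡ i) ⟨
      A j * u i                    ∎
      where open ≈-Reasoning

    zero-and-unit⇒independent : ∀ {i₀ j₀} → u i₀ ≈ 0 → ¬ u j₀ ≈ 0 →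
                                ¬ c i₀ * A j₀ ≈ c j₀ * A i₀
    zero-and-unit⇒independent {i₀} {j₀} u₀≈0 u₁≉0 proportional =
      u₁≉0 (*-cancelˡ (oneToK≉0 i₀) (begin
        A i₀ * u j₀   ≈⟨ proportional⇒u-proportional proportional ⟩
        A j₀ * u i₀   ≈⟨ *-congˡ (A j₀) u₀≈0 ⟩
        A j₀ * 0      ≡⟨ trans (*-zeroʳ (A j₀)) (sym (*-zeroʳ (A i₀))) ⟩
        A i₀ * 0      ∎))
      where open ≈-Reasoning

    open Avoidance c using (form; Avoids; avoiding-point)

    module _ (x z : ℕ) (avoids : Avoids x z) where

      private
        y = (z + k * (x * p)) % q
        R : Fin k → ℕ
        R i = x * u i + y * c i

      xp+y≈z : x * p + y ≈ z
      xp+y≈z = begin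
        x * p + y                   ≈⟨ +-congˡ (x * p) (%-≈ (z + k * (x * p))) ⟩
        x * p + (z + k * (x * p))
          ≡⟨ solve 3 (λ xp z k → xp :+ (z :+ k :* xp) := z :+ (xp :* k :+ xp)) refl (x * p) z k ⟩
        z + (x * p * k + x * p)     ≈⟨ +-congˡ z (a*k+a≈0 (x * p)) ⟩
        z + 0                       ≡⟨ +-identityʳ z ⟩
        z                           ∎
        where open ≈-Reasoning

      multiplier-digits : ∀ i → (x * p + y) * u i ≡ R i * p + y * A i
      multiplier-digits i = begin
        (x * p + y) * u i
          ≡⟨ cong ((x * p + y) *_) (u≡ i) ⟩
        (x * p + y) * (c i * p + A i)
          ≡⟨ solve 5 (λ x p y c a → (x :* p :+ y) :* (c :* p :+ a) := (x :* (c :* p :+ a) :+ y :* c) :* p :+ y :* a)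
                     refl x p y (c i) (A i) ⟩
        (x * (c i * p + A i) + y * c i) * p + y * A i
          ≡⟨ cong (λ w → (x * w + y * c i) * p + y * A i) (u≡ i) ⟨
        R i * p + y * A i ∎
        where open ≡-Reasoning

      R≈form : ∀ i → R i ≈ form x z i
      R≈form i = begin
        x * u i + y * c i               ≡⟨ cong (λ w → x * w + y * c i) (u≡ i) ⟩
        x * (c i * p + A i) + y * c i
          ≡⟨ solve 5 (λ x p y c a → x :* (c :* p :+ a) :+ y :* c := x :* a :+ (x :* p :+ y) :* c)
                     refl x p y (c i) (A i) ⟩
        x * A i + (x * p + y) * c i     ≈⟨ +-congˡ (x * A i) (*-congʳ (c i) xp+y≈z) ⟩
        form x z i                      ∎
        where open ≈-Reasoning

      avoiding⇒proper : Proper k p q u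
      avoiding⇒proper = proper-by-multiplier u (x * p + y) middle
        where
        middle : ∀ i → Middle ((x * p + y) * u i)
        middle i = subst Middle (sym (multiplier-digits i)) (middle-digits (R i) (y * A i) B<p (n≢0⇒n>0 r≢0) bound)
          where
          r = R i % q
          r≈form : r ≈ form x z i
          r≈form = ≈-trans (%-≈ (R i)) (R≈form i)
          r≢0 : r ≢ 0
          r≢0 r≡0 = avoids i (inj₁ (≈-trans (≈-sym r≈form) (≡⇒≈ r≡0)))
          r≢k : r ≢ k
          r≢k r≡k = avoids i (inj₂ (≈-trans (≈-sym r≈form) (≡⇒≈ r≡k)))
          B<p : y * A i < p
          B<p = ≤-<-trans (*-mono-≤ (ℕ.s≤s⁻¹ (m%n<n (z + k * (x * p)) q)) (<⇒≤ (s≤s (Finₚ.toℕ<n i))))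
                          kq<p
          bound : r * p + y * A i + p ≤ q * p
          bound = begin
            r * p + y * A i + p   ≤⟨ +-monoˡ-≤ p (+-monoʳ-≤ (r * p) (<⇒≤ B<p)) ⟩
            r * p + p + p         ≡⟨ solve 2 (λ r p → r :* p :+ p :+ p := (con 2 :+ r) :* p) refl r p ⟩
            (2 + r) * p           ≤⟨ *-monoˡ-≤ p (s≤s (≤∧≢⇒< (ℕ.s≤s⁻¹ (m%n<n (R i) q)) r≢k)) ⟩
            q * p                 ∎
            where open ≤-Reasoning

    proper : Proper k p q u
    proper with Finₚ.any? (λ i → u i ≈? 0)
    ... | no  no-zero = units-proper u (λ i u≈0 → no-zero (i , u≈0))
    ... | yes (i₀ , u₀≈0) with Finₚ.any? (λ j → ¬? (u j ≈? 0))
    ...   | no  all-zero    = divisible-proper u (λ j → decidable-stable (u j ≈? 0) (all-zero ∘ (j ,_)))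
    ...   | yes (j₀ , u₁≉0) = point⇒proper (avoiding-point (zero-and-unit⇒independent u₀≈0 u₁≉0))
      where
      point⇒proper : ∃[ x ] ∃[ z ] Avoids x z → Proper k p q u
      point⇒proper (x , z , avoids) = avoiding⇒proper x z avoids

proposition17 : (k p : ℕ) → Prime (suc k) → suc k % 2 ≡ 1 → Prime p → p % 2 ≡ 1 →
                  k * suc k < p →
                  ((u : Tuple k) → (∀ i → u i < suc k * p) → Proj p u (oneToK k) →
                    Proper k p (suc k) u)
                  × EventuallyProper k p (oneToK k)
proposition17 k zero     _       _ _ _ ()
proposition17 k (suc p′) q-prime _ _ _ kq<p =
  (λ u _ lift → proper u lift) , (suc k , s≤s z≤n , λ w _ lift improper → improper (proper w lift))
  where open Properness k p′ q-prime kq<p
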